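{- Let $\Gamma$ be a typing environment, $\sigma$ a type and $t$ a $\lambda$-term. Then $t\Vdash\mathtt T(\Gamma,\sigma)$ is derivable in the inhabitation algorithm for $\mathcal S_w$ if and only if $t$ is in $\beta$-normal form and there exists a standard derivation $\Pi\triangleright\Gamma\vdash_{\mathcal S_w} t:\sigma$.
   Context: $\lambda$-terms $t::=x\mid\lambda x.t\mid tu$; $t$ is in $\beta$-normal form if it contains no subterm $(\lambda x.u)v$. $\mathtt I$ denotes $\lambda z.z$. Types: $\sigma,\tau,\rho::=\alpha\mid A\to\tau$, $\alpha$ base types, multiset types $A=[\sigma_i]_{i\in I}$ finite possibly empty multisets ($[\,]$ empty). Environments $\Gamma$ map variables to multiset types, all but finitely many to $[\,]$; $\mathrm{dom}(\Gamma)=\{y:\Gamma(y)\ne[\,]\}$; $(\Gamma+\Delta)(y)=\Gamma(y)\uplus\Delta(y)$, $+_{i\in I}$ its $n$-ary version; $\Gamma\setminus y$ sets $y$ to $[\,]$; $x{:}A$ maps $x$ to $A$, others to $[\,]$; $\Gamma,x{:}A$ extends $\Gamma$ by mapping $x\notin\mathrm{dom}(\Gamma)$ to $A$. System $\mathcal S_w$: (var$_w$) $\Gamma,x{:}[\rho_1,\dots,\rho_n]\vdash x:\rho_i$ for $1\le i\le n$; ($\to$I) from $\Gamma\vdash t:\tau$ infer $\Gamma\setminus x\vdash\lambda x.t:\Gamma(x)\to\tau$; ($\to$E$_{\ne[]}$) from $\Gamma\vdash t:A\to\tau$, $\Delta\vdash u:A$, $A\ne[\,]$, infer $\Gamma+\Delta\vdash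 tu:\tau$; ($\to$E$_{[]}$) from $\Gamma\vdash t:[\,]\to\tau$ and $\Delta\vdash u:[\sigma]$ infer $\Gamma+\Delta\vdash tu:\tau$; (m) from $(\Delta_i\vdash t:\sigma_i)_{i\in I}$ ($I$ finite, possibly empty) infer $+_{i\in I}\Delta_i\vdash t:[\sigma_i]_{i\in I}$. A derivation is standard if every instance of ($\to$E$_{[]}$) has the form: from $\Gamma\vdash t:[\,]\to\rho$ and $\Delta\vdash\mathtt I:[[\alpha]\to\alpha]$ ($\alpha$ a base type) infer $\Gamma+\Delta\vdash t\,\mathtt I:\rho$. Inhabitation algorithm for $\mathcal S_w$ (judgements $t\Vdash\mathtt T(\Gamma,\sigma)$, $t\Vdash\mathtt{TI}(\Gamma,A)$, $t\Vdash\mathtt H^{x:[\rho]}(\Gamma,\tau)$): (Abs) from $t\Vdash\mathtt T(\Gamma+x{:}A,\tau)$, $x\notin\mathrm{dom}(\Gamma)$, infer $\lambda x.t\Vdash\mathtt T(\Gamma,A\to\tau)$; (Union) from $(t\Vdash\mathtt T(\Gamma_i,\sigma_i))_{i\in I}$ (same $t$) infer $t\Vdash\mathtt{TI}(+_{i\in I}\Gamma_i,[\sigma_i]_{i\in I})$; (Head$_{>0}$) from $\Gamma=\Gamma_1+\Gamma_2$, $t\Vdash\mathtt H^{x:[A_1\to\dots\to A_n\to B\to\tau]}(\Gamma_1,B\to\tau)$, $u\Vdash\mathtt{TI}(\Gamma_2,B)$, $B\ne[\,]$, $n\ge0$, infer $tu\Vdash\mathtt H^{x:[A_1\to\dots\to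 A_n\to B\to\tau]}(\Gamma,\tau)$; (Head$^{[]}_{>0}$) from $t\Vdash\mathtt H^{x:[A_1\to\dots\to A_n\to[\,]\to\tau]}(\Gamma,[\,]\to\tau)$, $n\ge0$, infer $t\,\mathtt I\Vdash\mathtt H^{x:[A_1\to\dots\to A_n\to[\,]\to\tau]}(\Gamma,\tau)$; (Head$_0$) $x\Vdash\mathtt H^{x:[\tau]}(\Gamma,\tau)$ for any $\Gamma$; (Head) from $t\Vdash\mathtt H^{x:[A_1\to\dots\to A_n\to\tau]}(\Gamma,\tau)$ infer $t\Vdash\mathtt T(\Gamma+x{:}[A_1\to\dots\to A_n\to\tau],\tau)$. -}

module Defs where

open import Data.Nat using (ℕ; _≟_)
open import Data.List using (List; []; _∷_; _++_)
open import Data.List.Relation.Unary.Any using (Any)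
open import Data.Product using (Σ; _×_; _,_)
open import Data.Unit using (⊤)
open import Relation.Nullary using (¬_; yes; no)
open import Relation.Binary.PropositionalEquality using (_≡_; _≢_)

data Term : Set where
  var : ℕ → Term
  lam : ℕ → Term → Term
  app : Term → Term → Term

data _⊑_ : Term → Term → Set where
  ⊑-refl : ∀ {t} → t ⊑ t
  ⊑-lam  : ∀ {s x t} → s ⊑ t → s ⊑ lam x t
  ⊑-appˡ : ∀ {s t u} → s ⊑ t → s ⊑ app t u
  ⊑-appʳ : ∀ {s t u} → s ⊑ u → s ⊑ app t u

IsRedex : Term → Set
IsRedex s = Σ ℕ λ x → Σ Term λ u → Σ Term λ v → s ≡ app (lam x u) v

BetaNormal : Term → Set
BetaNormal t = ∀ s → s ⊑ t → ¬ IsRedex s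

IsId : Term → Set
IsId t = Σ ℕ λ z → t ≡ lam z (var z)

-- Types; multiset types are represented by lists, considered up to
-- permutation (and recursively up to equivalence of types)

data Ty : Set where
  base : ℕ → Ty
  _⇒_  : List Ty → Ty → Ty

infixr 5 _⇒_

MTy : Set
MTy = List Ty

arrows : List MTy → Ty → Ty
arrows []       τ = τ
arrows (A ∷ As) τ = A ⇒ arrows As τ

data _≈ᵗ_ : Ty → Ty → Set
data _≈ᵐ_ : MTy → MTy → Set

data _≈ᵗ_ where
  base-≈ : ∀ {a} → base a ≈ᵗ base a
  ⇒-≈    : ∀ {A B σ τ} → A ≈ᵐ B → σ ≈ᵗ τ → (A ⇒ σ) ≈ᵗ (B ⇒ τ)

data _≈ᵐ_ where
  []-≈ : [] ≈ᵐ []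
  ∷-≈  : ∀ {σ τ A B C} → σ ≈ᵗ τ → A ≈ᵐ (B ++ C) → (σ ∷ A) ≈ᵐ (B ++ (τ ∷ C))

-- Environments: finite lists of bindings; Γ(y) is the multiset union of
-- all multisets bound to y.

Env : Set
Env = List (ℕ × MTy)

_⟨_⟩ : Env → ℕ → MTy
[]            ⟨ y ⟩ = []
((z , A) ∷ Γ) ⟨ y ⟩ with z ≟ y
... | yes _ = A ++ (Γ ⟨ y ⟩)
... | no  _ = Γ ⟨ y ⟩

∅ : Env
∅ = []

_+_ : Env → Env → Env
Γ + Δ = Γ ++ Δ

infixl 6 _+_

_∶_ : ℕ → MTy → Env
x ∶ A = (x , A) ∷ []

infix 7 _∶_

_∖_ : Env → ℕ → Env
[]            ∖ x = []
((z , A) ∷ Γ) ∖ x with z ≟ x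
... | yes _ = Γ ∖ x
... | no  _ = (z , A) ∷ (Γ ∖ x)

_∉dom_ : ℕ → Env → Set
x ∉dom Γ = Γ ⟨ x ⟩ ≡ []

_≈ᵉ_ : Env → Env → Set
Γ ≈ᵉ Δ = ∀ y → (Γ ⟨ y ⟩) ≈ᵐ (Δ ⟨ y ⟩)

infix 4 _≈ᵗ_ _≈ᵐ_ _≈ᵉ_

data _⊢_∷_ : Env → Term → Ty → Set
data _⊢ᵐ_∷_ : Env → Term → MTy → Set

data _⊢_∷_ where
  var-w  : ∀ {Θ x σ} (Γ : Env) (A : MTy) → x ∉dom Γ → Any (σ ≈ᵗ_) A →
           Θ ≈ᵉ (Γ + x ∶ A) → Θ ⊢ var x ∷ σ
  →I     : ∀ {Γ Θ x t τ σ} → Γ ⊢ t ∷ τ → Θ ≈ᵉ (Γ ∖ x) →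
           σ ≈ᵗ ((Γ ⟨ x ⟩) ⇒ τ) → Θ ⊢ lam x t ∷ σ
  →E≠[]  : ∀ {Γ Δ Θ t u A τ} → Γ ⊢ t ∷ (A ⇒ τ) → Δ ⊢ᵐ u ∷ A → A ≢ [] →
           Θ ≈ᵉ (Γ + Δ) → Θ ⊢ app t u ∷ τ
  →E[]   : ∀ {Γ Δ Θ t u σ τ} → Γ ⊢ t ∷ ([] ⇒ τ) → Δ ⊢ᵐ u ∷ (σ ∷ []) →
           Θ ≈ᵉ (Γ + Δ) → Θ ⊢ app t u ∷ τ

data _⊢ᵐ_∷_ where
  m-nil  : ∀ {Θ t} → Θ ≈ᵉ ∅ → Θ ⊢ᵐ t ∷ []
  m-cons : ∀ {Δ Δ' Θ t σ A} → Δ ⊢ t ∷ σ → Δ' ⊢ᵐ t ∷ A →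
           Θ ≈ᵉ (Δ + Δ') → Θ ⊢ᵐ t ∷ (σ ∷ A)

Standard  : ∀ {Γ t σ} → Γ ⊢ t ∷ σ → Set
Standardᵐ : ∀ {Γ t A} → Γ ⊢ᵐ t ∷ A → Set

Standard (var-w _ _ _ _ _) = ⊤
Standard (→I d _ _) = Standard d
Standard (→E≠[] d e _ _) = Standard d × Standardᵐ e
Standard (→E[] {u = u} {σ = σ} d e _) =
  Standard d × Standardᵐ e × IsId u ×
  Σ ℕ (λ α → σ ≡ ((base α ∷ []) ⇒ base α))

Standardᵐ (m-nil _) = ⊤
Standardᵐ (m-cons d e _) = Standard d × Standardᵐ e

data _⊩T⟨_,_⟩ : Term → Env → Ty → Set
data _⊩TI⟨_,_⟩ : Term → Env → MTy → Set
data _⊩H[_∶_]⟨_,_⟩ : Term → ℕ → Ty → Env → Ty → Set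

data _⊩T⟨_,_⟩ where
  Abs  : ∀ {Γ Θ x A t τ σ} → t ⊩T⟨ Γ + x ∶ A , τ ⟩ → x ∉dom Γ →
         Θ ≈ᵉ Γ → σ ≈ᵗ (A ⇒ τ) → lam x t ⊩T⟨ Θ , σ ⟩
  Head : ∀ {Γ Θ x t τ σ} (As : List MTy) →
         t ⊩H[ x ∶ arrows As τ ]⟨ Γ , τ ⟩ →
         Θ ≈ᵉ (Γ + x ∶ (arrows As τ ∷ [])) → σ ≈ᵗ τ → t ⊩T⟨ Θ , σ ⟩

data _⊩TI⟨_,_⟩ where
  Union-nil  : ∀ {Θ t} → Θ ≈ᵉ ∅ → t ⊩TI⟨ Θ , [] ⟩
  Union-cons : ∀ {Γ Δ Θ t σ A} → t ⊩T⟨ Γ , σ ⟩ → t ⊩TI⟨ Δ , A ⟩ →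
               Θ ≈ᵉ (Γ + Δ) → t ⊩TI⟨ Θ , σ ∷ A ⟩

data _⊩H[_∶_]⟨_,_⟩ where
  Head>0   : ∀ {Γ Γ₁ Γ₂ x t u B τ} (As : List MTy) →
             t ⊩H[ x ∶ arrows As (B ⇒ τ) ]⟨ Γ₁ , B ⇒ τ ⟩ →
             u ⊩TI⟨ Γ₂ , B ⟩ → B ≢ [] → Γ ≈ᵉ (Γ₁ + Γ₂) →
             app t u ⊩H[ x ∶ arrows As (B ⇒ τ) ]⟨ Γ , τ ⟩
  Head[]>0 : ∀ {Γ x t τ} (As : List MTy) →
             t ⊩H[ x ∶ arrows As ([] ⇒ τ) ]⟨ Γ , [] ⇒ τ ⟩ → (z : ℕ) →
             app t (lam z (var z)) ⊩H[ x ∶ arrows As ([] ⇒ τ) ]⟨ Γ , τ ⟩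
  Head0    : ∀ {Γ x τ} → var x ⊩H[ x ∶ τ ]⟨ Γ , τ ⟩

module Submission where

open import Defs
open import Data.Empty using (⊥; ⊥-elim)
open import Data.List using (List; []; _∷_; _++_)
open import Data.List.Membership.Propositional using (find)
open import Data.List.Membership.Propositional.Properties using (∈-∃++)
open import Data.List.Properties using (++-assoc; ++-identityʳ; ∷-injective)
open import Data.List.Relation.Unary.Any using (Any; here)
open import Data.List.Relation.Unary.Any.Properties using (++⁺ʳ)
import Data.List.Relation.Unary.Any as Any
open import Data.Nat using (_≟_)
open import Data.Product using (Σ; ∃; ∃₂; _×_; _,_; proj₁)
open import Data.Unit using (⊤; tt)
open import Relation.Binary.Bundles using (Setoid)
open import Relation.Binary.Structures using (IsEquivalence)
open import Relation.Nullary using (yes; no)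
open import Relation.Binary.PropositionalEquality
  using (_≡_; _≢_; refl; sym; trans; cong; subst)

-- Soundness: every rule of the algorithm is an admissible rule of S_w
-- producing standard derivations, and everything it builds is normal
-- because an application it builds always has a variable at its head.
-- Completeness: by induction on a standard derivation of a normal term,
-- which is a λ-abstraction or a head variable applied to normal
-- arguments; the derivation of the spine x u₁ … uₙ is unfolded into the
-- Head judgements, the standard (→E[]) instances being exactly
-- (Head[]>0), and the weakening built into (var_w) is absorbed by the
-- arbitrary environment of (Head0).

≈ᵗ-refl : ∀ {σ} → σ ≈ᵗ σ
≈ᵐ-refl : ∀ {A} → A ≈ᵐ A
≈ᵗ-refl {base a} = base-≈
≈ᵗ-refl {A ⇒ σ}  = ⇒-≈ ≈ᵐ-refl ≈ᵗ-refl
≈ᵐ-refl {[]}    = []-≈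
≈ᵐ-refl {σ ∷ A} = ∷-≈ {B = []} ≈ᵗ-refl ≈ᵐ-refl

≈ᵐ-reflexive : ∀ {A B} → A ≡ B → A ≈ᵐ B
≈ᵐ-reflexive refl = ≈ᵐ-refl

insertˡ-≈ : ∀ B {C A σ τ} → τ ≈ᵗ σ → B ++ C ≈ᵐ A → B ++ τ ∷ C ≈ᵐ σ ∷ A
insertˡ-≈ []      s p = ∷-≈ {B = []} s p
insertˡ-≈ (b ∷ B) {σ = σ} s (∷-≈ {B = A₁} s′ p) = ∷-≈ {B = σ ∷ A₁} s′ (insertˡ-≈ B s p)

≈ᵗ-sym : ∀ {σ τ} → σ ≈ᵗ τ → τ ≈ᵗ σ
≈ᵐ-sym : ∀ {A B} → A ≈ᵐ B → B ≈ᵐ A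
≈ᵗ-sym base-≈    = base-≈
≈ᵗ-sym (⇒-≈ p q) = ⇒-≈ (≈ᵐ-sym p) (≈ᵗ-sym q)
≈ᵐ-sym []-≈              = []-≈
≈ᵐ-sym (∷-≈ {B = B} s p) = insertˡ-≈ B (≈ᵗ-sym s) (≈ᵐ-sym p)

insert-remove-comm : ∀ {X : Set} (D₁ : List X) {D₂ E₁ E₂ : List X} {b t : X} →
  D₁ ++ D₂ ≡ E₁ ++ t ∷ E₂ →
  ∃₂ λ C₁ C₂ → ∃₂ λ F₁ F₂ →
  (D₁ ++ b ∷ D₂ ≡ C₁ ++ t ∷ C₂) × (C₁ ++ C₂ ≡ F₁ ++ b ∷ F₂) × (F₁ ++ F₂ ≡ E₁ ++ E₂)
insert-remove-comm [] {E₁ = E₁} {E₂} {b} refl = b ∷ E₁ , E₂ , [] , E₁ ++ E₂ , refl , refl , refl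
insert-remove-comm (d ∷ D₁) {D₂} {[]} {b = b} eq with ∷-injective eq
... | refl , refl = [] , D₁ ++ b ∷ D₂ , D₁ , D₂ , refl , refl , refl
insert-remove-comm (d ∷ D₁) {E₁ = _ ∷ _} eq with ∷-injective eq
... | refl , eq′ with insert-remove-comm D₁ eq′
... | C₁ , C₂ , F₁ , F₂ , e₁ , e₂ , e₃ =
  d ∷ C₁ , C₂ , d ∷ F₁ , F₂ , cong (d ∷_) e₁ , cong (d ∷_) e₂ , cong (d ∷_) e₃

-- ∷-≈ inverted at an arbitrary position of the left-hand list, as
-- transitivity requires.
≈ᵐ-remove : ∀ B₁ {τ B₂ C} → B₁ ++ τ ∷ B₂ ≈ᵐ C →
  ∃₂ λ C₁ C₂ → ∃ λ τ′ → (C ≡ C₁ ++ τ′ ∷ C₂) × τ ≈ᵗ τ′ × B₁ ++ B₂ ≈ᵐ C₁ ++ C₂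
≈ᵐ-remove []       (∷-≈ {B = C₁} {C = C₂} s p) = C₁ , C₂ , _ , refl , s , p
≈ᵐ-remove (b ∷ B₁) (∷-≈ {τ = b′} {B = D₁} s p) with ≈ᵐ-remove B₁ p
... | _ , _ , τ′ , eq , s′ , q with insert-remove-comm D₁ {b = b′} eq
... | C₁ , C₂ , F₁ , F₂ , e₁ , e₂ , e₃ =
  C₁ , C₂ , τ′ , e₁ , s′ , subst (_ ≈ᵐ_) (sym e₂) (∷-≈ {B = F₁} s (subst (_ ≈ᵐ_) (sym e₃) q))

≈ᵗ-trans : ∀ {σ τ ρ} → σ ≈ᵗ τ → τ ≈ᵗ ρ → σ ≈ᵗ ρ
≈ᵐ-trans : ∀ {A B C} → A ≈ᵐ B → B ≈ᵐ C → A ≈ᵐ C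
≈ᵗ-trans base-≈      q           = q
≈ᵗ-trans (⇒-≈ p p′) (⇒-≈ q q′) = ⇒-≈ (≈ᵐ-trans p q) (≈ᵗ-trans p′ q′)
≈ᵐ-trans []-≈              q = q
≈ᵐ-trans (∷-≈ {B = B} s p) q with ≈ᵐ-remove B q
... | _ , _ , _ , refl , s′ , q′ = ∷-≈ (≈ᵗ-trans s s′) (≈ᵐ-trans p q′)

++-congᵐ : ∀ {A A′ B B′} → A ≈ᵐ A′ → B ≈ᵐ B′ → A ++ B ≈ᵐ A′ ++ B′
++-congᵐ []-≈ q = q
++-congᵐ {B′ = B′} (∷-≈ {τ = τ} {B = A₁} {C = A₂} s p) q
  rewrite ++-assoc A₁ (τ ∷ A₂) B′ =
  ∷-≈ {B = A₁} s (subst (_ ≈ᵐ_) (++-assoc A₁ A₂ B′) (++-congᵐ p q))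

++-commᵐ : ∀ A B → A ++ B ≈ᵐ B ++ A
++-commᵐ []      B = ≈ᵐ-reflexive (sym (++-identityʳ B))
++-commᵐ (a ∷ A) B = ∷-≈ {B = B} ≈ᵗ-refl (++-commᵐ A B)

Any-split : ∀ {X : Set} {P : X → Set} {A} → Any P A → ∃₂ λ A₁ A₂ → ∃ λ a → A ≡ A₁ ++ a ∷ A₂ × P a
Any-split any with find any
... | a , a∈A , pa with ∈-∃++ a∈A
... | A₁ , A₂ , eq = A₁ , A₂ , a , eq , pa

⟨⟩-∷-≡ : ∀ {z y A} Γ → z ≡ y → ((z , A) ∷ Γ) ⟨ y ⟩ ≡ A ++ Γ ⟨ y ⟩
⟨⟩-∷-≡ {z} {y} Γ z≡y with z ≟ y
... | yes _   = refl
... | no z≢y = ⊥-elim (z≢y z≡y)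

⟨⟩-∷-≢ : ∀ {z y A} Γ → z ≢ y → ((z , A) ∷ Γ) ⟨ y ⟩ ≡ Γ ⟨ y ⟩
⟨⟩-∷-≢ {z} {y} Γ z≢y with z ≟ y
... | yes z≡y = ⊥-elim (z≢y z≡y)
... | no _    = refl

⟨⟩-+ : ∀ Γ Δ y → (Γ + Δ) ⟨ y ⟩ ≡ Γ ⟨ y ⟩ ++ Δ ⟨ y ⟩
⟨⟩-+ []            Δ y = refl
⟨⟩-+ ((z , A) ∷ Γ) Δ y with z ≟ y
... | yes _ = trans (cong (A ++_) (⟨⟩-+ Γ Δ y)) (sym (++-assoc A _ _))
... | no _  = ⟨⟩-+ Γ Δ y

⟨⟩-∶-≡ : ∀ x A → (x ∶ A) ⟨ x ⟩ ≡ A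
⟨⟩-∶-≡ x A = trans (⟨⟩-∷-≡ {x} {x} {A} [] refl) (++-identityʳ A)

⟨⟩-+∶-≡ : ∀ Γ x A → (Γ + x ∶ A) ⟨ x ⟩ ≡ Γ ⟨ x ⟩ ++ A
⟨⟩-+∶-≡ Γ x A = trans (⟨⟩-+ Γ (x ∶ A) x) (cong (Γ ⟨ x ⟩ ++_) (⟨⟩-∶-≡ x A))

⟨⟩-+∶-≢ : ∀ Γ {x y} A → x ≢ y → (Γ + x ∶ A) ⟨ y ⟩ ≡ Γ ⟨ y ⟩
⟨⟩-+∶-≢ Γ {y = y} A x≢y =
  trans (⟨⟩-+ Γ _ y) (trans (cong (Γ ⟨ y ⟩ ++_) (⟨⟩-∷-≢ [] x≢y)) (++-identityʳ _))

⟨⟩-∖-≡ : ∀ Γ x → (Γ ∖ x) ⟨ x ⟩ ≡ []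
⟨⟩-∖-≡ []            x = refl
⟨⟩-∖-≡ ((z , A) ∷ Γ) x with z ≟ x
... | yes _   = ⟨⟩-∖-≡ Γ x
... | no z≢x = trans (⟨⟩-∷-≢ (Γ ∖ x) z≢x) (⟨⟩-∖-≡ Γ x)

⟨⟩-∖-≢ : ∀ Γ {x y} → x ≢ y → (Γ ∖ x) ⟨ y ⟩ ≡ Γ ⟨ y ⟩
⟨⟩-∖-≢ []            x≢y = refl
⟨⟩-∖-≢ ((z , A) ∷ Γ) {x} {y} x≢y with z ≟ x
... | yes refl = trans (⟨⟩-∖-≢ Γ x≢y) (sym (⟨⟩-∷-≢ Γ x≢y))
... | no _ with z ≟ y
...   | yes _ = cong (A ++_) (⟨⟩-∖-≢ Γ x≢y)
...   | no _  = ⟨⟩-∖-≢ Γ x≢y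

≈ᵉ-isEquivalence : IsEquivalence _≈ᵉ_
≈ᵉ-isEquivalence = record
  { refl  = λ _ → ≈ᵐ-refl
  ; sym   = λ p y → ≈ᵐ-sym (p y)
  ; trans = λ p q y → ≈ᵐ-trans (p y) (q y)
  }

≈ᵉ-setoid : Setoid _ _
≈ᵉ-setoid = record { isEquivalence = ≈ᵉ-isEquivalence }

open IsEquivalence ≈ᵉ-isEquivalence using () renaming (refl to ≈ᵉ-refl)

+-congᵉ : ∀ Γ Γ′ Δ Δ′ → Γ ≈ᵉ Γ′ → Δ ≈ᵉ Δ′ → Γ + Δ ≈ᵉ Γ′ + Δ′
+-congᵉ Γ Γ′ Δ Δ′ p q y = ≈ᵐ-trans (≈ᵐ-reflexive (⟨⟩-+ Γ Δ y))
  (≈ᵐ-trans (++-congᵐ (p y) (q y)) (≈ᵐ-reflexive (sym (⟨⟩-+ Γ′ Δ′ y))))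

+-commᵉ : ∀ Γ Δ → Γ + Δ ≈ᵉ Δ + Γ
+-commᵉ Γ Δ y = ≈ᵐ-trans (≈ᵐ-reflexive (⟨⟩-+ Γ Δ y))
  (≈ᵐ-trans (++-commᵐ (Γ ⟨ y ⟩) (Δ ⟨ y ⟩)) (≈ᵐ-reflexive (sym (⟨⟩-+ Δ Γ y))))

+-regroupᵉ : ∀ Θ Γ Δ Γ₁ Ξ → Θ ≈ᵉ Γ + Δ → Γ ≈ᵉ Γ₁ + Ξ → Θ ≈ᵉ (Γ₁ + Δ) + Ξ
+-regroupᵉ Θ Γ Δ Γ₁ Ξ Θ≈Γ+Δ Γ≈Γ₁+Ξ = begin
  Θ             ≈⟨ Θ≈Γ+Δ ⟩
  Γ + Δ         ≈⟨ +-congᵉ Γ (Γ₁ + Ξ) Δ Δ Γ≈Γ₁+Ξ (≈ᵉ-refl {Δ}) ⟩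
  (Γ₁ + Ξ) + Δ  ≡⟨ ++-assoc Γ₁ Ξ Δ ⟩
  Γ₁ + (Ξ + Δ)  ≈⟨ +-congᵉ Γ₁ Γ₁ (Ξ + Δ) (Δ + Ξ) (≈ᵉ-refl {Γ₁}) (+-commᵉ Ξ Δ) ⟩
  Γ₁ + (Δ + Ξ)  ≡⟨ ++-assoc Γ₁ Δ Ξ ⟨
  (Γ₁ + Δ) + Ξ  ∎
  where open import Relation.Binary.Reasoning.Setoid ≈ᵉ-setoid

∶-++ : ∀ x {A B C} → A ≈ᵐ B ++ C → x ∶ A ≈ᵉ x ∶ B + x ∶ C
∶-++ x {A} {B} {C} A≈B++C y with x ≟ y
... | yes x≡y = ≈ᵐ-trans (≈ᵐ-reflexive (++-identityʳ A)) (≈ᵐ-trans A≈B++C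
  (≈ᵐ-reflexive (cong (B ++_) (sym (trans (⟨⟩-∷-≡ [] x≡y) (++-identityʳ C))))))
... | no x≢y = ≈ᵐ-reflexive (sym (⟨⟩-∷-≢ [] x≢y))

+∶-split : ∀ Γ x {A B C} → A ≈ᵐ B ++ C → Γ + x ∶ A ≈ᵉ (Γ + x ∶ B) + x ∶ C
+∶-split Γ x {A} {B} {C} A≈B++C = begin
  Γ + x ∶ A                ≈⟨ +-congᵉ Γ Γ (x ∶ A) (x ∶ B + x ∶ C) (≈ᵉ-refl {Γ}) (∶-++ x A≈B++C) ⟩
  Γ + (x ∶ B + x ∶ C)      ≡⟨ ++-assoc Γ (x ∶ B) (x ∶ C) ⟨
  (Γ + x ∶ B) + x ∶ C      ∎
  where open import Relation.Binary.Reasoning.Setoid ≈ᵉ-setoid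

+-identityʳᵉ : ∀ Γ → Γ ≈ᵉ Γ + ∅
+-identityʳᵉ Γ rewrite ++-identityʳ Γ = ≈ᵉ-refl {Γ}

∖-split : ∀ Γ x → Γ ≈ᵉ (Γ ∖ x) + x ∶ Γ ⟨ x ⟩
∖-split Γ x y with x ≟ y
... | yes refl = ≈ᵐ-reflexive
  (sym (trans (⟨⟩-+∶-≡ (Γ ∖ x) x (Γ ⟨ x ⟩)) (cong (_++ Γ ⟨ x ⟩) (⟨⟩-∖-≡ Γ x))))
... | no x≢y = ≈ᵐ-reflexive (sym (trans (⟨⟩-+∶-≢ (Γ ∖ x) _ x≢y) (⟨⟩-∖-≢ Γ x≢y)))

⟨⟩-+∶-fresh : ∀ Γ x A → x ∉dom Γ → (Γ + x ∶ A) ⟨ x ⟩ ≡ A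
⟨⟩-+∶-fresh Γ x A x∉Γ = trans (⟨⟩-+∶-≡ Γ x A) (cong (_++ A) x∉Γ)

+∶-∖-fresh : ∀ Γ x A → x ∉dom Γ → Γ ≈ᵉ (Γ + x ∶ A) ∖ x
+∶-∖-fresh Γ x A x∉Γ y with x ≟ y
... | yes refl = ≈ᵐ-reflexive (trans x∉Γ (sym (⟨⟩-∖-≡ (Γ + x ∶ A) x)))
... | no x≢y  = ≈ᵐ-reflexive (sym (trans (⟨⟩-∖-≢ (Γ + x ∶ A) x≢y) (⟨⟩-+∶-≢ Γ A x≢y)))

NotLam : Term → Set
NotLam (var _)   = ⊤
NotLam (lam _ _) = ⊥
NotLam (app _ _) = ⊤

BetaNormal-var : ∀ {x} → BetaNormal (var x)
BetaNormal-var _ ⊑-refl (_ , _ , _ , ())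

BetaNormal-lam⁺ : ∀ {x t} → BetaNormal t → BetaNormal (lam x t)
BetaNormal-lam⁺ bn _ ⊑-refl   (_ , _ , _ , ())
BetaNormal-lam⁺ bn s (⊑-lam p) = bn s p

BetaNormal-lam⁻ : ∀ {x t} → BetaNormal (lam x t) → BetaNormal t
BetaNormal-lam⁻ bn s p = bn s (⊑-lam p)

BetaNormal-app⁺ : ∀ {t u} → BetaNormal t → BetaNormal u → NotLam t → BetaNormal (app t u)
BetaNormal-app⁺ bt bu nl _ ⊑-refl     (_ , _ , _ , refl) = nl
BetaNormal-app⁺ bt bu nl s (⊑-appˡ p) = bt s p
BetaNormal-app⁺ bt bu nl s (⊑-appʳ p) = bu s p

BetaNormal-app⁻ : ∀ {t u} → BetaNormal (app t u) → BetaNormal t × BetaNormal u × NotLam t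
BetaNormal-app⁻ {t} bn = (λ s p → bn s (⊑-appˡ p)) , (λ s p → bn s (⊑-appʳ p)) , notLam t bn
  where
  notLam : ∀ t {u} → BetaNormal (app t u) → NotLam t
  notLam (var _)       _  = tt
  notLam (lam y v) {u} bn = bn _ ⊑-refl (y , v , u , refl)
  notLam (app _ _)     _  = tt

infix 4 _⊢ˢ_∷_ _⊢ˢᵐ_∷_

_⊢ˢ_∷_ : Env → Term → Ty → Set
Γ ⊢ˢ t ∷ σ = Σ (Γ ⊢ t ∷ σ) Standard

_⊢ˢᵐ_∷_ : Env → Term → MTy → Set
Γ ⊢ˢᵐ t ∷ A = Σ (Γ ⊢ᵐ t ∷ A) Standardᵐ

⊢ˢ-resp-≈ᵉ : ∀ {Θ Θ′ t σ} → Θ′ ≈ᵉ Θ → Θ ⊢ˢ t ∷ σ → Θ′ ⊢ˢ t ∷ σ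
⊢ˢ-resp-≈ᵉ p (var-w Γ A x∉Γ σ∈A q , _) = var-w Γ A x∉Γ σ∈A (λ y → ≈ᵐ-trans (p y) (q y)) , tt
⊢ˢ-resp-≈ᵉ p (→I d q s , sd)          = →I d (λ y → ≈ᵐ-trans (p y) (q y)) s , sd
⊢ˢ-resp-≈ᵉ p (→E≠[] d e A≢[] q , sd)  = →E≠[] d e A≢[] (λ y → ≈ᵐ-trans (p y) (q y)) , sd
⊢ˢ-resp-≈ᵉ p (→E[] d e q , sd)        = →E[] d e (λ y → ≈ᵐ-trans (p y) (q y)) , sd

⊢ˢ-resp-≈ᵗ : ∀ {Θ t σ τ} → σ ≈ᵗ τ → Θ ⊢ˢ t ∷ σ → Θ ⊢ˢ t ∷ τ
⊢ˢ-resp-≈ᵗ σ≈τ (var-w Γ A x∉Γ σ∈A q , _) =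
  var-w Γ A x∉Γ (Any.map (≈ᵗ-trans (≈ᵗ-sym σ≈τ)) σ∈A) q , tt
⊢ˢ-resp-≈ᵗ σ≈τ (→I d q s , sd) = →I d q (≈ᵗ-trans (≈ᵗ-sym σ≈τ) s) , sd
⊢ˢ-resp-≈ᵗ σ≈τ (→E≠[] d e A≢[] q , sd , se) with ⊢ˢ-resp-≈ᵗ (⇒-≈ ≈ᵐ-refl σ≈τ) (d , sd)
... | d′ , sd′ = →E≠[] d′ e A≢[] q , sd′ , se
⊢ˢ-resp-≈ᵗ σ≈τ (→E[] d e q , sd , rest) with ⊢ˢ-resp-≈ᵗ (⇒-≈ []-≈ σ≈τ) (d , sd)
... | d′ , sd′ = →E[] d′ e q , sd′ , rest

-- Standardness allows any base type α in (→E[]); we use α = 0.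
⊢ˢ-I : ∀ z → ∅ ⊢ˢᵐ lam z (var z) ∷ (((base 0 ∷ []) ⇒ base 0) ∷ [])
⊢ˢ-I z = m-cons {Δ = ∅} {Δ' = ∅} ⊢I (m-nil λ _ → []-≈) (λ _ → []-≈) , tt , tt
  where
  ⊢I : ∅ ⊢ lam z (var z) ∷ ((base 0 ∷ []) ⇒ base 0)
  ⊢I = →I {Γ = z ∶ (base 0 ∷ [])}
          (var-w [] (base 0 ∷ []) refl (here base-≈) (≈ᵉ-refl {z ∶ (base 0 ∷ [])}))
          (+∶-∖-fresh ∅ z (base 0 ∷ []) refl)
          (⇒-≈ (≈ᵐ-reflexive (sym (⟨⟩-∶-≡ z (base 0 ∷ [])))) base-≈)

⊩T-resp-≈ᵉ : ∀ {Θ Θ′ t σ} → Θ′ ≈ᵉ Θ → t ⊩T⟨ Θ , σ ⟩ → t ⊩T⟨ Θ′ , σ ⟩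
⊩T-resp-≈ᵉ p (Abs h x∉Γ q s)  = Abs h x∉Γ (λ y → ≈ᵐ-trans (p y) (q y)) s
⊩T-resp-≈ᵉ p (Head As h q s) = Head As h (λ y → ≈ᵐ-trans (p y) (q y)) s

⊩H-weaken : ∀ {Γ t x ρ τ} Δ → t ⊩H[ x ∶ ρ ]⟨ Γ , τ ⟩ → t ⊩H[ x ∶ ρ ]⟨ Γ + Δ , τ ⟩
⊩H-weaken {Γ} Δ (Head>0 {Γ₁ = Γ₁} {Γ₂} As h i B≢[] q) =
  Head>0 As (⊩H-weaken Δ h) i B≢[] (+-regroupᵉ (Γ + Δ) Γ Δ Γ₁ Γ₂ (≈ᵉ-refl {Γ + Δ}) q)
⊩H-weaken Δ (Head[]>0 As h z) = Head[]>0 As (⊩H-weaken Δ h) z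
⊩H-weaken Δ Head0             = Head0

⊩T-sound : ∀ {Θ t σ} → t ⊩T⟨ Θ , σ ⟩ → BetaNormal t × Θ ⊢ˢ t ∷ σ
⊩TI-sound : ∀ {Θ t A} → t ⊩TI⟨ Θ , A ⟩ → Θ ⊢ˢᵐ t ∷ A
⊩TI-betaNormal : ∀ {Θ t A} → t ⊩TI⟨ Θ , A ⟩ → A ≢ [] → BetaNormal t
⊩H-sound : ∀ {Γ t x ρ τ} → t ⊩H[ x ∶ ρ ]⟨ Γ , τ ⟩ →
  BetaNormal t × NotLam t × Γ + x ∶ (ρ ∷ []) ⊢ˢ t ∷ τ

⊩T-sound (Abs {Γ} {x = x} {A} h x∉Γ q s) with ⊩T-sound h
... | bn , d , sd = BetaNormal-lam⁺ bn ,
  →I d (λ y → ≈ᵐ-trans (q y) (+∶-∖-fresh Γ x A x∉Γ y))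
       (≈ᵗ-trans s (⇒-≈ (≈ᵐ-reflexive (sym (⟨⟩-+∶-fresh Γ x A x∉Γ))) ≈ᵗ-refl)) , sd
⊩T-sound (Head As h q s) with ⊩H-sound h
... | bn , _ , D = bn , ⊢ˢ-resp-≈ᵗ (≈ᵗ-sym s) (⊢ˢ-resp-≈ᵉ q D)

⊩TI-sound (Union-nil p) = m-nil p , tt
⊩TI-sound (Union-cons h i p) with ⊩T-sound h | ⊩TI-sound i
... | _ , d , sd | e , se = m-cons d e p , sd , se

⊩TI-betaNormal (Union-nil _)      []≢[] = ⊥-elim ([]≢[] refl)
⊩TI-betaNormal (Union-cons h _ _) _     = proj₁ (⊩T-sound h)

⊩H-sound (Head>0 {Γ} {Γ₁} {Γ₂} {x} {B = B} {τ} As h i B≢[] q) with ⊩H-sound h | ⊩TI-sound i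
... | bn , nl , d , sd | e , se =
  BetaNormal-app⁺ bn (⊩TI-betaNormal i B≢[]) nl , tt ,
  →E≠[] d e B≢[] (+-regroupᵉ (Γ + X) Γ X Γ₁ Γ₂ (≈ᵉ-refl {Γ + X}) q) , sd , se
  where X = x ∶ (arrows As (B ⇒ τ) ∷ [])
⊩H-sound (Head[]>0 {Γ} {x} {τ = τ} As h z) with ⊩H-sound h | ⊢ˢ-I z
... | bn , nl , d , sd | e , se =
  BetaNormal-app⁺ bn (BetaNormal-lam⁺ BetaNormal-var) nl , tt ,
  →E[] d e (+-identityʳᵉ (Γ + x ∶ (arrows As ([] ⇒ τ) ∷ []))) , sd , se , (z , refl) , (0 , refl)
⊩H-sound (Head0 {Γ} {x} {τ}) = BetaNormal-var , tt ,
  var-w (Δ ∖ x) (Δ ⟨ x ⟩) (⟨⟩-∖-≡ Δ x)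
    (subst (Any (τ ≈ᵗ_)) (sym (⟨⟩-+∶-≡ Γ x (τ ∷ []))) (++⁺ʳ (Γ ⟨ x ⟩) (here ≈ᵗ-refl)))
    (∖-split Δ x) , tt
  where Δ = Γ + x ∶ (τ ∷ [])

arrows-snoc : ∀ As B τ → arrows (As ++ B ∷ []) τ ≡ arrows As (B ⇒ τ)
arrows-snoc []       B τ = refl
arrows-snoc (A ∷ As) B τ = cong (A ⇒_) (arrows-snoc As B τ)

data Headed (Θ : Env) (t : Term) (τ : Ty) : Set where
  headed : ∀ {x Γ} As → t ⊩H[ x ∶ arrows As τ ]⟨ Γ , τ ⟩ →
           Θ ≈ᵉ Γ + x ∶ (arrows As τ ∷ []) → Headed Θ t τ

Headed⇒⊩T : ∀ {Θ t τ} → Headed Θ t τ → t ⊩T⟨ Θ , τ ⟩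
Headed⇒⊩T (headed As h q) = Head As h q ≈ᵗ-refl

headed-app : ∀ {Θ t x Γ B τ} As → t ⊩H[ x ∶ arrows As (B ⇒ τ) ]⟨ Γ , τ ⟩ →
             Θ ≈ᵉ Γ + x ∶ (arrows As (B ⇒ τ) ∷ []) → Headed Θ t τ
headed-app {Θ} {t} {x} {Γ} {B} {τ} As =
  subst (λ ρ → t ⊩H[ x ∶ ρ ]⟨ Γ , τ ⟩ → Θ ≈ᵉ Γ + x ∶ (ρ ∷ []) → Headed Θ t τ)
        (arrows-snoc As B τ) (headed (As ++ B ∷ []))

⊢-complete : ∀ {Θ t σ} (d : Θ ⊢ t ∷ σ) → Standard d → BetaNormal t → t ⊩T⟨ Θ , σ ⟩
⊢ᵐ-complete : ∀ {Θ t A} (e : Θ ⊢ᵐ t ∷ A) → Standardᵐ e → BetaNormal t → t ⊩TI⟨ Θ , A ⟩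
⊢-complete-headed : ∀ {Θ t τ} (d : Θ ⊢ t ∷ τ) → Standard d → BetaNormal t → NotLam t →
                    Headed Θ t τ

⊢-complete {t = var _}   d sd bn = Headed⇒⊩T (⊢-complete-headed d sd bn tt)
⊢-complete {t = app _ _} d sd bn = Headed⇒⊩T (⊢-complete-headed d sd bn tt)
⊢-complete {t = lam x _} (→I {Γ} d q s) sd bn =
  Abs {Γ = Γ ∖ x} (⊩T-resp-≈ᵉ (λ y → ≈ᵐ-sym (∖-split Γ x y)) (⊢-complete d sd (BetaNormal-lam⁻ bn)))
      (⟨⟩-∖-≡ Γ x) q s

⊢ᵐ-complete (m-nil p)      _         _  = Union-nil p
⊢ᵐ-complete (m-cons d e p) (sd , se) bn = Union-cons (⊢-complete d sd bn) (⊢ᵐ-complete e se bn) p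

⊢-complete-headed (var-w {Θ} {x} {τ} Γ A _ τ∈A q) _ _ _ with Any-split τ∈A
... | A₁ , A₂ , a , refl , τ≈a = headed {Γ = Γ + x ∶ (A₁ ++ A₂)} [] Head0
  λ y → ≈ᵐ-trans (q y) (+∶-split Γ x {B = A₁ ++ A₂} {C = τ ∷ []} A≈ y)
  where
  A≈ : A₁ ++ a ∷ A₂ ≈ᵐ (A₁ ++ A₂) ++ τ ∷ []
  A≈ = ≈ᵐ-trans (insertˡ-≈ A₁ (≈ᵗ-sym τ≈a) ≈ᵐ-refl) (++-commᵐ (τ ∷ []) (A₁ ++ A₂))
⊢-complete-headed (→E≠[] {Γ} {Δ} {Θ} {A = A} {τ} d e A≢[] q) (sd , se) bn _
  with BetaNormal-app⁻ bn
... | bt , bu , nlt with ⊢-complete-headed d sd bt nlt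
... | headed {x} {Γ₁} As h p =
  headed-app {Γ = Γ₁ + Δ} As (Head>0 As h (⊢ᵐ-complete e se bu) A≢[] (≈ᵉ-refl {Γ₁ + Δ}))
             (+-regroupᵉ Θ Γ Δ Γ₁ (x ∶ (arrows As (A ⇒ τ) ∷ [])) q p)
⊢-complete-headed (→E[] {Γ} {Δ} {Θ} {τ = τ} d e q) (sd , _ , (z , refl) , _) bn _
  with BetaNormal-app⁻ bn
... | bt , _ , nlt with ⊢-complete-headed d sd bt nlt
... | headed {x} {Γ₁} As h p =
  headed-app {Γ = Γ₁ + Δ} As (Head[]>0 As (⊩H-weaken Δ h) z)
             (+-regroupᵉ Θ Γ Δ Γ₁ (x ∶ (arrows As ([] ⇒ τ) ∷ [])) q p)

theorem4p14 : (Γ : Env) (σ : Ty) (t : Term) →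
    (t ⊩T⟨ Γ , σ ⟩ → BetaNormal t × Σ (Γ ⊢ t ∷ σ) Standard) ×
    (BetaNormal t × Σ (Γ ⊢ t ∷ σ) Standard → t ⊩T⟨ Γ , σ ⟩)
theorem4p14 Γ σ t = ⊩T-sound , λ (bn , d , sd) → ⊢-complete d sd bn
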